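{- Let $t>1$ be odd and let $1\le i\ne j\le 4t$ with $i\equiv j\pmod 4$. Then there exists exactly one integer $n$ with $5\le n\le 2t+2$ and $n\equiv1\pmod 4$ such that the generalized coboundary matrices $N_i$ and $N_j$ have a $-1$ entry in a common position of row $n$.
   Context: $G=\mathbb{Z}_t\times\mathbb{Z}_2^2=\langle x,u,v\mid x^t=u^2=v^2=1,\ uv=vu\rangle$, with elements ordered $g_{4m+1}=x^m$, $g_{4m+2}=x^mu$, $g_{4m+3}=x^mv$, $g_{4m+4}=x^muv$ for $0\le m\le t-1$. For $1\le i\le 4t$ let $\delta_i:G\to\{\pm1\}$ with $\delta_i(g)=-1$ iff $g=g_i$. The generalized coboundary matrix $N_i$ is the $4t\times4t$ matrix with $(s,j)$ entry $\delta_i(g_j)\delta_i(g_sg_j)$. -}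

module Defs where

open import Data.Nat using (ℕ; zero; suc; _+_; _*_; _∸_; NonZero)
open import Data.Nat.DivMod using (_/_; _%_)
open import Data.Bool using (Bool; true; false; _xor_; if_then_else_)
open import Data.Product using (_×_; _,_)
open import Data.Integer using (ℤ; +_; -_) renaming (_*_ to _*ℤ_)
open import Relation.Nullary using (does)
open import Relation.Binary.PropositionalEquality using (_≡_)
import Data.Nat.Properties as ℕP
import Data.Bool.Properties as BP
open import Data.Product.Properties using (≡-dec)

-- Elements of G = Z_t × Z_2^2 : x^m u^a v^b is represented by (m , a , b),
-- with 0 ≤ m < t (exponent of x reduced mod t).
G : Set
G = ℕ × Bool × Bool

_≟G_ : (g h : G) → Relation.Nullary.Dec (g ≡ h)
_≟G_ = ≡-dec ℕP._≟_ (≡-dec BP._≟_ BP._≟_)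

mulG : (t : ℕ) → .{{NonZero t}} → G → G → G
mulG t (m , a , b) (m' , a' , b') = ((m + m') % t , a xor a' , b xor b')

uvPart : ℕ → Bool × Bool
uvPart 0 = false , false
uvPart 1 = true , false
uvPart 2 = false , true
uvPart _ = true , true

-- the ordering g_{4m+1} = x^m, g_{4m+2} = x^m u, g_{4m+3} = x^m v, g_{4m+4} = x^m uv
-- (1-based index k; meaningful for 1 ≤ k ≤ 4t)
elt : (t : ℕ) → .{{NonZero t}} → ℕ → G
elt t k with uvPart ((k ∸ 1) % 4)
... | (a , b) = (((k ∸ 1) / 4) % t , a , b)

δ : (t : ℕ) → .{{NonZero t}} → ℕ → G → ℤ
δ t i g = if does (g ≟G elt t i) then - (+ 1) else + 1

N : (t : ℕ) → .{{NonZero t}} → ℕ → ℕ → ℕ → ℤ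
N t i s j = δ t i (elt t j) *ℤ δ t i (mulG t (elt t s) (elt t j))

-- Write g_i = x^a w and g_j = x^b w with the same w ∈ ℤ₂² and a ≠ b.  In the row of
-- g_n = x^m ≠ 1 the entry (n , c) of N_i is −1 exactly when g_c = g_i or x^m g_c = g_i, so
-- N_i and N_j share a −1 in that row iff x^m carries g_i to g_j or g_j to g_i, that is
-- m ≡ ±(b − a) (mod t).  The rows n ≡ 1 (mod 4) with 5 ≤ n ≤ 2t + 2 are those of x^m with
-- 1 ≤ m ≤ k, where t = 2k + 1, and exactly one such m is congruent to b − a or to a − b.
module Submission where

open import Defs
open import Data.Nat using (ℕ; suc; _+_; _*_; _∸_; _≤_; _<_; NonZero; _≤?_; s≤s; z≤n)
open import Data.Nat.DivMod
open import Data.Nat.Properties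
open import Data.Nat.Tactic.RingSolver using (solve-∀)
open import Data.Bool using (false)
open import Data.Integer using (+_; -_) renaming (_*_ to _*ℤ_)
open import Data.Integer.Properties using () renaming (*-identityˡ to *ℤ-identityˡ)
open import Data.Product using (_×_; ∃; ∃!; _,_; proj₁)
open import Data.Sum using (_⊎_; inj₁; inj₂; swap) renaming (map to ⊎-map)
open import Data.Empty using (⊥-elim)
open import Function using (_∘_)
open import Relation.Nullary using (Dec; yes; no)
open import Relation.Binary.Definitions using (tri<; tri≈; tri>)
open import Relation.Binary.PropositionalEquality
open import Algebra.Properties.CommutativeSemigroup +-commutativeSemigroup
  using (interchange; xy∙z≈xz∙y)

[1+m]%n≡[1+o]%n⇒m%n≡o%n : ∀ m o n → suc m % suc n ≡ suc o % suc n → m % suc n ≡ o % suc n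
[1+m]%n≡[1+o]%n⇒m%n≡o%n m o n eq = begin
  m % suc n                             ≡⟨ via-suc m ⟩
  (suc m % suc n + n % suc n) % suc n   ≡⟨ cong (λ r → (r + n % suc n) % suc n) eq ⟩
  (suc o % suc n + n % suc n) % suc n   ≡⟨ via-suc o ⟨
  o % suc n                             ∎
  where
  open ≡-Reasoning
  via-suc : ∀ x → x % suc n ≡ (suc x % suc n + n % suc n) % suc n
  via-suc x = begin
    x % suc n          ≡⟨ [m+n]%n≡m%n x (suc n) ⟨
    (x + suc n) % suc n ≡⟨ cong (_% suc n) (+-suc x n) ⟩
    (suc x + n) % suc n ≡⟨ %-distribˡ-+ (suc x) n (suc n) ⟩
    _                   ∎

m%n≡o%n∧m/n≡o/n⇒m≡o : ∀ {m o n} .{{_ : NonZero n}} → m % n ≡ o % n → m / n ≡ o / n → m ≡ o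
m%n≡o%n∧m/n≡o/n⇒m≡o {m} {o} {n} r q = begin
  m                   ≡⟨ m≡m%n+[m/n]*n m n ⟩
  m % n + m / n * n   ≡⟨ cong₂ (λ x y → x + y * n) r q ⟩
  o % n + o / n * n   ≡⟨ m≡m%n+[m/n]*n o n ⟨
  o                   ∎
  where open ≡-Reasoning

m%2≡1⇒m≡1+[m/2]+[m/2] : ∀ m → m % 2 ≡ 1 → m ≡ suc (m / 2 + m / 2)
m%2≡1⇒m≡1+[m/2]+[m/2] m odd = begin
  m                     ≡⟨ m≡m%n+[m/n]*n m 2 ⟩
  m % 2 + m / 2 * 2     ≡⟨ cong₂ _+_ odd (double (m / 2)) ⟩
  suc (m / 2 + m / 2)   ∎
  where
  open ≡-Reasoning
  double : ∀ k → k * 2 ≡ k + k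
  double = solve-∀

-- x^m x^a = x^b in ℤ_t, with w counting the wrap-arounds.
Shift : ℕ → ℕ → ℕ → ℕ → Set
Shift t m a b = ∃ λ w → m + a ≡ b + w * t

module _ {t : ℕ} .{{_ : NonZero t}} where

  %⇒Shift : ∀ {m a b} → (m + a) % t ≡ b → Shift t m a b
  %⇒Shift {m} {a} eq = (m + a) / t , trans (m≡m%n+[m/n]*n (m + a) t) (cong (_+ (m + a) / t * t) eq)

  Shift⇒% : ∀ {m a b} → b < t → Shift t m a b → (m + a) % t ≡ b
  Shift⇒% {b = b} b<t (w , eq) = trans (cong (_% t) eq) (trans ([m+kn]%n≡m%n b w t) (m<n⇒m%n≡m b<t))

  Shift-cancel : ∀ {m m' a b} → Shift t m a b → Shift t m' a b → m % t ≡ m' % t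
  Shift-cancel {m} {m'} {a} {b} (w , eq) (w' , eq') = begin
    m % t                ≡⟨ [m+kn]%n≡m%n m w' t ⟨
    (m + w' * t) % t     ≡⟨ cong (_% t) (+-cancelʳ-≡ a _ _ same-sum) ⟩
    (m' + w * t) % t     ≡⟨ [m+kn]%n≡m%n m' w t ⟩
    m' % t               ∎
    where
    open ≡-Reasoning
    same-sum : m + w' * t + a ≡ m' + w * t + a
    same-sum = begin
      m + w' * t + a      ≡⟨ xy∙z≈xz∙y m _ a ⟩
      m + a + w' * t      ≡⟨ cong (_+ w' * t) eq ⟩
      b + w * t + w' * t  ≡⟨ xy∙z≈xz∙y b _ _ ⟩
      b + w' * t + w * t  ≡⟨ cong (_+ w * t) eq' ⟨
      m' + a + w * t      ≡⟨ xy∙z≈xz∙y m' a _ ⟩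
      m' + w * t + a      ∎

  Shift-round-trip : ∀ {m m' a b} → Shift t m a b → Shift t m' b a → (m + m') % t ≡ 0
  Shift-round-trip {m} {m'} {a} {b} (w , eq) (w' , eq') = begin
    (m + m') % t              ≡⟨ cong (_% t) (+-cancelʳ-≡ (a + b) _ _ same-sum) ⟩
    (w * t + w' * t) % t      ≡⟨ [m+kn]%n≡m%n (w * t) w' t ⟩
    (w * t) % t               ≡⟨ m*n%n≡0 w t ⟩
    0                         ∎
    where
    open ≡-Reasoning
    same-sum : m + m' + (a + b) ≡ w * t + w' * t + (a + b)
    same-sum = begin
      m + m' + (a + b)              ≡⟨ interchange m m' a b ⟩
      m + a + (m' + b)              ≡⟨ cong₂ _+_ eq eq' ⟩
      b + w * t + (a + w' * t)      ≡⟨ interchange b _ a _ ⟩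
      b + a + (w * t + w' * t)      ≡⟨ cong (_+ (w * t + w' * t)) (+-comm b a) ⟩
      a + b + (w * t + w' * t)      ≡⟨ +-comm (a + b) _ ⟩
      w * t + w' * t + (a + b)      ∎

-- For t = 2k + 1: m is the distance from a to b on the cycle ℤ_t.
CyclicDistance : (t k a b m : ℕ) → Set
CyclicDistance t k a b m = 1 ≤ m × m ≤ k × (Shift t m a b ⊎ Shift t m b a)

module _ {t k : ℕ} .{{_ : NonZero t}} (t≡1+2k : t ≡ suc (k + k)) where

  +-mono-≤k⇒<t : ∀ {m m'} → m ≤ k → m' ≤ k → m + m' < t
  +-mono-≤k⇒<t m≤k m'≤k = ≤-trans (s≤s (+-mono-≤ m≤k m'≤k)) (≤-reflexive (sym t≡1+2k))

  ≤k⇒<t : ∀ {m} → m ≤ k → m < t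
  ≤k⇒<t m≤k = ≤-<-trans (m≤m+n _ 0) (+-mono-≤k⇒<t m≤k z≤n)

  ≤k-%-injective : ∀ {m m'} → m ≤ k → m' ≤ k → m % t ≡ m' % t → m ≡ m'
  ≤k-%-injective {m} {m'} m≤k m'≤k eq = begin
    m       ≡⟨ m<n⇒m%n≡m (≤k⇒<t m≤k) ⟨
    m % t   ≡⟨ eq ⟩
    m' % t  ≡⟨ m<n⇒m%n≡m (≤k⇒<t m'≤k) ⟩
    m'      ∎
    where open ≡-Reasoning

  ≤k-no-round-trip : ∀ {m m'} → 1 ≤ m → m ≤ k → m' ≤ k → (m + m') % t ≢ 0
  ≤k-no-round-trip (s≤s z≤n) m≤k m'≤k eq with trans (sym (m<n⇒m%n≡m (+-mono-≤k⇒<t m≤k m'≤k))) eq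
  ... | ()

  cyclicDistance-unique : ∀ {a b m m'} → CyclicDistance t k a b m → CyclicDistance t k a b m' → m ≡ m'
  cyclicDistance-unique (_ , m≤k , inj₁ s) (_ , m'≤k , inj₁ s') = ≤k-%-injective m≤k m'≤k (Shift-cancel s s')
  cyclicDistance-unique (_ , m≤k , inj₂ s) (_ , m'≤k , inj₂ s') = ≤k-%-injective m≤k m'≤k (Shift-cancel s s')
  cyclicDistance-unique (1≤m , m≤k , inj₁ s) (_ , m'≤k , inj₂ s') =
    ⊥-elim (≤k-no-round-trip 1≤m m≤k m'≤k (Shift-round-trip s s'))
  cyclicDistance-unique (1≤m , m≤k , inj₂ s) (_ , m'≤k , inj₁ s') =
    ⊥-elim (≤k-no-round-trip 1≤m m≤k m'≤k (Shift-round-trip s s'))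

  cyclicDistance-exists-< : ∀ {a b} → a < b → b < t → ∃ (CyclicDistance t k a b)
  cyclicDistance-exists-< {a} {b} a<b b<t with b ∸ a ≤? k
  ... | yes d≤k =
    b ∸ a , m<n⇒0<n∸m a<b , d≤k , inj₁ (0 , trans (m∸n+n≡m (<⇒≤ a<b)) (sym (+-identityʳ b)))
  ... | no  d≰k = t ∸ (b ∸ a) , m<n⇒0<n∸m d<t , t∸d≤k , inj₂ (1 , wraps)
    where
    open ≡-Reasoning
    d = b ∸ a
    d<t : d < t
    d<t = ≤-<-trans (m∸n≤m b a) b<t
    t∸d≤k : t ∸ d ≤ k
    t∸d≤k = ≤-trans (∸-monoʳ-≤ t (≰⇒> d≰k)) (≤-reflexive (begin
      t ∸ suc k             ≡⟨ cong (_∸ suc k) t≡1+2k ⟩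
      suc (k + k) ∸ suc k   ≡⟨ m+n∸m≡n k k ⟩
      k                     ∎))
    wraps : t ∸ d + b ≡ a + 1 * t
    wraps = begin
      t ∸ d + b         ≡⟨ cong (λ x → t ∸ d + x) (m∸n+n≡m (<⇒≤ a<b)) ⟨
      t ∸ d + (d + a)   ≡⟨ +-assoc (t ∸ d) d a ⟨
      t ∸ d + d + a     ≡⟨ cong (_+ a) (m∸n+n≡m (<⇒≤ d<t)) ⟩
      t + a             ≡⟨ +-comm t a ⟩
      a + t             ≡⟨ cong (λ x → a + x) (+-identityʳ t) ⟨
      a + 1 * t         ∎

  cyclicDistance-exists : ∀ {a b} → a < t → b < t → a ≢ b → ∃ (CyclicDistance t k a b)
  cyclicDistance-exists {a} {b} a<t b<t a≢b with <-cmp a b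
  ... | tri< a<b _ _ = cyclicDistance-exists-< a<b b<t
  ... | tri≈ _ a≡b _ = ⊥-elim (a≢b a≡b)
  ... | tri> _ _ b<a with cyclicDistance-exists-< b<a a<t
  ...   | m , 1≤m , m≤k , s = m , 1≤m , m≤k , swap s

module _ {t : ℕ} .{{_ : NonZero t}} where

  δ≡-1⇒≡ : ∀ i {g} → δ t i g ≡ - (+ 1) → g ≡ elt t i
  δ≡-1⇒≡ i {g} eq with g ≟G elt t i
  ... | yes g≡gᵢ = g≡gᵢ

  δ-at : ∀ i → δ t i (elt t i) ≡ - (+ 1)
  δ-at i with elt t i ≟G elt t i
  ... | yes _ = refl
  ... | no gᵢ≢gᵢ = ⊥-elim (gᵢ≢gᵢ refl)

  δ-off : ∀ i {g} → g ≢ elt t i → δ t i g ≡ + 1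
  δ-off i {g} g≢gᵢ with g ≟G elt t i
  ... | yes g≡gᵢ = ⊥-elim (g≢gᵢ g≡gᵢ)
  ... | no _ = refl

  N≡-1⇒ : ∀ i n c → N t i n c ≡ - (+ 1) → elt t c ≡ elt t i ⊎ mulG t (elt t n) (elt t c) ≡ elt t i
  N≡-1⇒ i n c eq = by-cases (elt t c ≟G elt t i)
    where
    open ≡-Reasoning
    gₙgc = mulG t (elt t n) (elt t c)
    by-cases : Dec (elt t c ≡ elt t i) → elt t c ≡ elt t i ⊎ gₙgc ≡ elt t i
    by-cases (yes c≡i) = inj₁ c≡i
    by-cases (no c≢i) = inj₂ (δ≡-1⇒≡ i (begin
      δ t i gₙgc              ≡⟨ *ℤ-identityˡ _ ⟨
      + 1 *ℤ δ t i gₙgc       ≡⟨ cong (_*ℤ δ t i gₙgc) (δ-off i c≢i) ⟨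
      N t i n c               ≡⟨ eq ⟩
      - (+ 1)                 ∎))

  shared-negative-entry : ∀ x y n → mulG t (elt t n) (elt t x) ≡ elt t y → elt t x ≢ elt t y →
                          N t x n x ≡ - (+ 1) × N t y n x ≡ - (+ 1)
  shared-negative-entry x y n gₙgₓ≡gᵧ gₓ≢gᵧ =
    cong₂ _*ℤ_ (δ-at x) (trans (cong (δ t x) gₙgₓ≡gᵧ) (δ-off x (gₓ≢gᵧ ∘ sym))) ,
    cong₂ _*ℤ_ (δ-off y gₓ≢gᵧ) (trans (cong (δ t y) gₙgₓ≡gᵧ) (δ-at y))

  shared-negative-entry⇒ : ∀ i j n c → elt t i ≢ elt t j → N t i n c ≡ - (+ 1) → N t j n c ≡ - (+ 1) →
                           mulG t (elt t n) (elt t i) ≡ elt t j ⊎ mulG t (elt t n) (elt t j) ≡ elt t i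
  shared-negative-entry⇒ i j n c gᵢ≢gⱼ eqᵢ eqⱼ with N≡-1⇒ i n c eqᵢ | N≡-1⇒ j n c eqⱼ
  ... | inj₁ c≡i  | inj₁ c≡j  = ⊥-elim (gᵢ≢gⱼ (trans (sym c≡i) c≡j))
  ... | inj₁ c≡i  | inj₂ nc≡j = inj₁ (subst (λ g → mulG t (elt t n) g ≡ elt t j) c≡i nc≡j)
  ... | inj₂ nc≡i | inj₁ c≡j  = inj₂ (subst (λ g → mulG t (elt t n) g ≡ elt t i) c≡j nc≡i)
  ... | inj₂ nc≡i | inj₂ nc≡j = ⊥-elim (gᵢ≢gⱼ (trans (sym nc≡i) nc≡j))

module _ {t : ℕ} .{{_ : NonZero t}} where

  /4<t : ∀ {x} → x < 4 * t → x / 4 < t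
  /4<t {x} x<4t = m<n*o⇒m/o<n (subst (x <_) (*-comm 4 t) x<4t)

  elt-suc : ∀ {x} → x < 4 * t → elt t (suc x) ≡ (x / 4 , uvPart (x % 4))
  elt-suc {x} x<4t with uvPart (x % 4)
  ... | u , v = cong (λ q → q , u , v) (m<n⇒m%n≡m (/4<t x<4t))

  elt-row : ∀ {m} → m < t → elt t (suc (m * 4)) ≡ (m , false , false)
  elt-row {m} m<t = trans (elt-suc m*4<4t) (cong₂ (λ q r → q , uvPart r) (m*n/n≡m m 4) (m*n%n≡0 m 4))
    where
    m*4<4t : m * 4 < 4 * t
    m*4<4t = subst (m * 4 <_) (*-comm t 4) (*-monoˡ-< 4 m<t)

  row-action : ∀ {m x} → m < t → x < 4 * t →
               mulG t (elt t (suc (m * 4))) (elt t (suc x)) ≡ ((m + x / 4) % t , uvPart (x % 4))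
  row-action m<t x<4t = cong₂ (mulG t) (elt-row m<t) (elt-suc x<4t)

  Shift⇒row-maps : ∀ {m x y} → m < t → x < 4 * t → y < 4 * t → x % 4 ≡ y % 4 → Shift t m (x / 4) (y / 4) →
                   mulG t (elt t (suc (m * 4))) (elt t (suc x)) ≡ elt t (suc y)
  Shift⇒row-maps {m} {x} {y} m<t x<4t y<4t x≡y[4] s = begin
    mulG t (elt t (suc (m * 4))) (elt t (suc x))  ≡⟨ row-action {m = m} {x = x} m<t x<4t ⟩
    ((m + x / 4) % t , uvPart (x % 4))            ≡⟨ cong₂ (λ q r → q , uvPart r)
                                                           (Shift⇒% {m = m} {a = x / 4} (/4<t y<4t) s) x≡y[4] ⟩
    (y / 4 , uvPart (y % 4))                      ≡⟨ elt-suc y<4t ⟨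
    elt t (suc y)                                 ∎
    where open ≡-Reasoning

  row-maps⇒Shift : ∀ {m x y} → m < t → x < 4 * t → y < 4 * t →
                   mulG t (elt t (suc (m * 4))) (elt t (suc x)) ≡ elt t (suc y) → Shift t m (x / 4) (y / 4)
  row-maps⇒Shift {m} {x} m<t x<4t y<4t eq =
    %⇒Shift {m = m} {a = x / 4} (cong proj₁ (trans (sym (row-action {m = m} {x = x} m<t x<4t)) (trans eq (elt-suc y<4t))))

module _ {t k : ℕ} (t≡1+2k : t ≡ suc (k + k)) where

  2t+2≡[1+k]*4 : 2 * t + 2 ≡ suc k * 4
  2t+2≡[1+k]*4 = trans (cong (λ s → 2 * s + 2) t≡1+2k) (arith k)
    where
    arith : ∀ k → 2 * suc (k + k) + 2 ≡ suc k * 4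
    arith = solve-∀

  row⇒exponent : ∀ {n} → 5 ≤ n → n ≤ 2 * t + 2 → n % 4 ≡ 1 →
                 ∃ λ m → n ≡ suc (m * 4) × 1 ≤ m × m ≤ k
  row⇒exponent {n} 5≤n n≤2t+2 n≡1[4] = n / 4 , n≡1+4m , m≥n⇒m/n>0 (≤-trans (n≤1+n 4) 5≤n) , m≤k
    where
    n≡1+4m : n ≡ suc (n / 4 * 4)
    n≡1+4m = trans (m≡m%n+[m/n]*n n 4) (cong (_+ n / 4 * 4) n≡1[4])
    m≤k : n / 4 ≤ k
    m≤k = ≤-pred (*-cancelʳ-< 4 (n / 4) (suc k)
            (≤-trans (≤-reflexive (sym n≡1+4m)) (≤-trans n≤2t+2 (≤-reflexive 2t+2≡[1+k]*4))))

  exponent⇒row : ∀ {m} → 1 ≤ m → m ≤ k → 5 ≤ suc (m * 4) × suc (m * 4) ≤ 2 * t + 2 × suc (m * 4) % 4 ≡ 1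
  exponent⇒row {m} 1≤m m≤k =
    s≤s (*-monoˡ-≤ 4 1≤m) ,
    ≤-trans (s≤s (≤-trans (*-monoˡ-≤ 4 m≤k) (m≤n+m (k * 4) 3))) (≤-reflexive (sym 2t+2≡[1+k]*4)) ,
    [m+kn]%n≡m%n 1 m 4

module SharedNegativeRows {t k : ℕ} .{{_ : NonZero t}} (t≡1+2k : t ≡ suc (k + k))
  {i j : ℕ} (i<4t : i < 4 * t) (j<4t : j < 4 * t) (i≢j : i ≢ j) (i≡j[4] : i % 4 ≡ j % 4) where

  SharedNegativeEntry : ℕ → Set
  SharedNegativeEntry n = ∃ (λ c → 1 ≤ c × c ≤ 4 * t × N t (suc i) n c ≡ - (+ 1) × N t (suc j) n c ≡ - (+ 1))

  SharedNegativeRow : ℕ → Set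
  SharedNegativeRow n = 5 ≤ n × n ≤ 2 * t + 2 × n % 4 ≡ 1 × SharedNegativeEntry n

  i/4≢j/4 : i / 4 ≢ j / 4
  i/4≢j/4 = i≢j ∘ m%n≡o%n∧m/n≡o/n⇒m≡o i≡j[4]

  gᵢ≢gⱼ : elt t (suc i) ≢ elt t (suc j)
  gᵢ≢gⱼ eq = i/4≢j/4 (cong proj₁ (trans (sym (elt-suc i<4t)) (trans eq (elt-suc j<4t))))

  distance⇒row : ∀ {m} → CyclicDistance t k (i / 4) (j / 4) m → SharedNegativeRow (suc (m * 4))
  distance⇒row {m} (1≤m , m≤k , s) with exponent⇒row {k = k} t≡1+2k 1≤m m≤k
  ... | 5≤n , n≤2t+2 , n≡1[4] = 5≤n , n≤2t+2 , n≡1[4] , shared s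
    where
    m<t : m < t
    m<t = ≤k⇒<t {k = k} t≡1+2k m≤k
    shared : Shift t m (i / 4) (j / 4) ⊎ Shift t m (j / 4) (i / 4) → SharedNegativeEntry (suc (m * 4))
    shared (inj₁ s) with shared-negative-entry (suc i) (suc j) (suc (m * 4))
                           (Shift⇒row-maps m<t i<4t j<4t i≡j[4] s) gᵢ≢gⱼ
    ... | eᵢ , eⱼ = suc i , s≤s z≤n , i<4t , eᵢ , eⱼ
    shared (inj₂ s) with shared-negative-entry (suc j) (suc i) (suc (m * 4))
                           (Shift⇒row-maps m<t j<4t i<4t (sym i≡j[4]) s) (gᵢ≢gⱼ ∘ sym)
    ... | eⱼ , eᵢ = suc j , s≤s z≤n , j<4t , eᵢ , eⱼ

  row⇒distance : ∀ {n} → SharedNegativeRow n → ∃ λ m → n ≡ suc (m * 4) × CyclicDistance t k (i / 4) (j / 4) m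
  row⇒distance (5≤n , n≤2t+2 , n≡1[4] , c , _ , _ , eᵢ , eⱼ)
    with row⇒exponent {k = k} t≡1+2k 5≤n n≤2t+2 n≡1[4]
  ... | m , refl , 1≤m , m≤k =
    m , refl , 1≤m , m≤k ,
    ⊎-map (row-maps⇒Shift m<t i<4t j<4t) (row-maps⇒Shift m<t j<4t i<4t)
          (shared-negative-entry⇒ (suc i) (suc j) (suc (m * 4)) c gᵢ≢gⱼ eᵢ eⱼ)
    where
    m<t : m < t
    m<t = ≤k⇒<t {k = k} t≡1+2k m≤k

  ∃!sharedNegativeRow : ∃! _≡_ SharedNegativeRow
  ∃!sharedNegativeRow with cyclicDistance-exists {k = k} t≡1+2k (/4<t i<4t) (/4<t j<4t) i/4≢j/4
  ... | m , distance = suc (m * 4) , distance⇒row distance , unique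
    where
    unique : ∀ {n} → SharedNegativeRow n → suc (m * 4) ≡ n
    unique row with row⇒distance row
    ... | m' , refl , distance' = cong (λ x → suc (x * 4)) (cyclicDistance-unique {k = k} t≡1+2k distance distance')

lemma2 : (t : ℕ) → .{{_ : NonZero t}} → 1 < t → t % 2 ≡ 1 →
    (i j : ℕ) → 1 ≤ i → i ≤ 4 * t → 1 ≤ j → j ≤ 4 * t → i ≢ j → i % 4 ≡ j % 4 →
    ∃! _≡_ (λ n → 5 ≤ n × n ≤ 2 * t + 2 × n % 4 ≡ 1 ×
    ∃ (λ c → 1 ≤ c × c ≤ 4 * t ×
    N t i n c ≡ - (+ 1) × N t j n c ≡ - (+ 1)))
lemma2 t _ t-odd (suc i) (suc j) (s≤s z≤n) i<4t (s≤s z≤n) j<4t 1+i≢1+j 1+i≡1+j[4] = ∃!sharedNegativeRow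
  where
  open SharedNegativeRows {k = t / 2} (m%2≡1⇒m≡1+[m/2]+[m/2] t t-odd) i<4t j<4t
         (1+i≢1+j ∘ cong suc) ([1+m]%n≡[1+o]%n⇒m%n≡o%n i j 3 1+i≡1+j[4])
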